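{- Let $p \geq q \geq 4$ be integers and consider $C_{2p} \square C_{2q}$ with vertices $v_{i,j}$ as described in the context. Let $B_1 = (v_{p,2q-1}, v_{p,q-1})$. Then every safe set for $B_1$ is of the form $O_{i,j}=\{v_{i,j}, v_{2p-i,j}, v_{i,2q-2-j}, v_{2p-i,2q-2-j}\}$ for some $i,j$ (indices modulo $2p$ and $2q$). Further, the set $R_1 = \{v_{x,y} : x \in \{0,\ldots,p\},\ y \in \{q-1,\ldots,2q-1\}\}$ is a cop house for $B_1$, and if $f$ is a translation of the graph (a map $v_{i,j}\mapsto v_{i+s,j+t}$ for fixed integers $s,t$) and $B_2=f(B_1)$, then $f(R_1)$ is a cop house for $B_2$.
   Context: $C_{2p}\square C_{2q}$ is the Cartesian product of the cycles of orders $2p$ and $2q$. Its vertices are labelled $v_{i,j}$ with $i$ taken modulo $2p$ and $j$ taken modulo $2q$, where $v_{i,j}$ is adjacent exactly to $v_{i\pm1,j}$ and $v_{i,j\pm1}$. For an ordered probe $B=(b_1,b_2)$ and a vertex $v$, the distance vector is $\vec D(B,v)=[d(v,b_1),d(v,b_2)]$. A safe set for $B$ is a set of vertices all having the same distance vector to $B$, containing at least two vertices. A cop house for $B$ is a set of vertices no two distinct members of which have the same distance vector to $B$. -}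

module Defs where

open import Data.Nat as ℕ using (ℕ; zero; suc; _≤_; _<_; NonZero; >-nonZero; s≤s; z≤n)
open import Data.Nat.Properties using (≤-trans; m≤m+n)
open import Data.Integer as ℤ using (ℤ; +_; _+_; _-_; 1ℤ)
open import Data.Integer.DivMod using (_%ℕ_; n%ℕd<d)
open import Data.Fin using (Fin; fromℕ<; toℕ)
open import Data.Product using (Σ; ∃; _×_; _,_; proj₁; proj₂)
open import Data.Sum using (_⊎_)
open import Relation.Binary.PropositionalEquality using (_≡_)
open import Relation.Nullary using (¬_)
open import Function.Bundles using (_⇔_)

wrap : (n : ℕ) → .{{_ : NonZero n}} → ℤ → Fin n
wrap n z = fromℕ< (n%ℕd<d z n)

module Torus (p q : ℕ) (4≤q : 4 ≤ q) (q≤p : q ≤ p) where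

  N M : ℕ
  N = 2 ℕ.* p
  M = 2 ℕ.* q

  private
    0<q : 0 < q
    0<q = ≤-trans (s≤s z≤n) 4≤q
    0<p : 0 < p
    0<p = ≤-trans 0<q q≤p
    0<N : 0 < N
    0<N = ≤-trans 0<p (m≤m+n p _)
    0<M : 0 < M
    0<M = ≤-trans 0<q (m≤m+n q _)

  instance
    nzN : NonZero N
    nzN = >-nonZero 0<N
    nzM : NonZero M
    nzM = >-nonZero 0<M

  Vertex : Set
  Vertex = Fin N × Fin M

  v : ℤ → ℤ → Vertex
  v i j = wrap N i , wrap M j

  Adj : Vertex → Vertex → Set
  Adj a b = Σ ℤ λ i → Σ ℤ λ j → a ≡ v i j ×
    (b ≡ v (i + 1ℤ) j ⊎ b ≡ v (i - 1ℤ) j ⊎ b ≡ v i (j + 1ℤ) ⊎ b ≡ v i (j - 1ℤ))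

  data Walk : Vertex → Vertex → ℕ → Set where
    here : ∀ {a} → Walk a a 0
    step : ∀ {a b c k} → Adj a b → Walk b c k → Walk a c (suc k)

  Dist : Vertex → Vertex → ℕ → Set
  Dist a b k = Walk a b k × (∀ m → m < k → ¬ Walk a b m)

  Probe : Set
  Probe = Vertex × Vertex

  HasDV : Probe → Vertex → ℕ × ℕ → Set
  HasDV (b₁ , b₂) x (k₁ , k₂) = Dist x b₁ k₁ × Dist x b₂ k₂

  VSet : Set₁
  VSet = Vertex → Set

  CopHouse : Probe → VSet → Set
  CopHouse B R = ∀ x y → R x → R y → ∀ dv → HasDV B x dv → HasDV B y dv → x ≡ y

  -- the (maximal) safe set with distance vector dv: all vertices with D(B,x) = dv,
  -- a safe set when it contains at least two vertices
  SafeSetOf : Probe → ℕ × ℕ → VSet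
  SafeSetOf B dv x = HasDV B x dv

  AtLeastTwo : VSet → Set
  AtLeastTwo S = Σ Vertex λ x → Σ Vertex λ y → S x × S y × ¬ x ≡ y

  O : ℤ → ℤ → VSet
  O i j x = x ≡ v i j ⊎ x ≡ v (+ N - i) j ⊎ x ≡ v i (+ M - + 2 - j)
            ⊎ x ≡ v (+ N - i) (+ M - + 2 - j)

  B₁ : Probe
  B₁ = v (+ p) (+ M - 1ℤ) , v (+ p) (+ q - 1ℤ)

  R₁ : VSet
  R₁ w = Σ ℕ λ x → Σ ℕ λ y → x ≤ p × q ℕ.∸ 1 ≤ y × y ≤ M ℕ.∸ 1 × w ≡ v (+ x) (+ y)

  translate : ℤ → ℤ → Vertex → Vertex
  translate s t (a , b) = v (+ toℕ a + s) (+ toℕ b + t)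

  image : (Vertex → Vertex) → VSet → VSet
  image f R w = Σ Vertex λ x → R x × f x ≡ w

  mapProbe : (Vertex → Vertex) → Probe → Probe
  mapProbe f (b₁ , b₂) = f b₁ , f b₂

{-# OPTIONS --safe #-}
module Submission where

open import Defs
open import Data.Nat as ℕ
  using (ℕ; zero; suc; _≤_; _<_; _⊓_; _∸_; ∣_-_∣; _%_; z≤n; s≤s; NonZero)
open import Data.Nat.Properties
open import Data.Nat.DivMod using (m<n⇒m%n≡m; n%n≡0)
open import Data.Nat.Divisibility using (divides; n∣m⇒m%n≡0)
import Data.Nat.Tactic.RingSolver as ℕ-Solver
open import Data.Integer as ℤ using (ℤ; -[1+_]; _-_; -_; 0ℤ; 1ℤ; -1ℤ)
import Data.Integer.Properties as ℤ
open import Data.Integer.DivMod using (_%ℕ_; _/ℕ_; n%ℕd<d; a≡a%ℕn+[a/ℕn]*n)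
open import Data.Integer.Tactic.RingSolver using (solve-∀)
open import Data.Fin using (Fin; toℕ)
open import Data.Fin.Properties using (toℕ-fromℕ<; toℕ-injective; toℕ<n)
open import Data.Product using (Σ; ∃-syntax; _×_; _,_; proj₁; proj₂)
open import Data.Sum using (_⊎_; inj₁; inj₂)
open import Data.Empty using (⊥-elim)
open import Function.Bundles using (_⇔_; mk⇔; Equivalence)
open import Relation.Nullary using (yes; no)
open import Relation.Binary.Definitions using (tri<; tri≈; tri>)
open import Relation.Binary.PropositionalEquality

-- The graph distance on C_{2p} □ C_{2q} is the sum of the cyclic distances of the two
-- coordinates: that sum changes by at most one along an edge, and it is realised by walking
-- first along a row and then along a column. The probe vertices b₁ = v_{p,2q-1} and
-- b₂ = v_{p,q-1} lie in the same row and are antipodal in their column, so the distance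
-- vector of v_{x,y} is (a + (q - u), a + u) with a = |x - p| and u = |y - (q - 1)|; it
-- determines exactly the pair (a, u). The vertices sharing (a, u) with v_{i,j} are its images
-- under the reflections x ↦ 2p - x and y ↦ 2q - 2 - y, automorphisms fixing b₁ and b₂,
-- whereas on R₁ both x ↦ a and y ↦ u are injective. Translations are automorphisms too, so
-- they carry cop houses to cop houses.

module _ where

  open import Data.Nat using (_+_; _*_)

  WithinOne : ℕ → ℕ → Set
  WithinOne a b = a ≤ suc b × b ≤ suc a

  WithinOne-sym : ∀ {a b} → WithinOne a b → WithinOne b a
  WithinOne-sym (a≤ , b≤) = b≤ , a≤

  shorterArc : ℕ → ℕ → ℕ
  shorterArc n d = d ⊓ (n ∸ d)

  cycleDist : ℕ → ℕ → ℕ → ℕ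
  cycleDist n x y = shorterArc n ∣ x - y ∣

  m∸n≤1+m∸1+n : ∀ m n → m ∸ n ≤ suc (m ∸ suc n)
  m∸n≤1+m∸1+n zero    zero    = z≤n
  m∸n≤1+m∸1+n zero    (suc n) = z≤n
  m∸n≤1+m∸1+n (suc m) zero    = ≤-refl
  m∸n≤1+m∸1+n (suc m) (suc n) = m∸n≤1+m∸1+n m n

  shorterArc-suc : ∀ n d → WithinOne (shorterArc n d) (shorterArc n (suc d))
  shorterArc-suc n d =
    ⊓-mono-≤ (≤-trans (n≤1+n d) (n≤1+n (suc d))) (m∸n≤1+m∸1+n n d) ,
    ⊓-mono-≤ ≤-refl (≤-trans (∸-monoʳ-≤ n (n≤1+n d)) (n≤1+n (n ∸ d)))

  shorterArc-mirror : ∀ {n d} → d ≤ n → shorterArc n (n ∸ d) ≡ shorterArc n d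
  shorterArc-mirror {n} {d} d≤n = trans (cong ((n ∸ d) ⊓_) (m∸[m∸n]≡n d≤n)) (⊓-comm (n ∸ d) d)

  shorterArc-short : ∀ {h d} → d ≤ h → shorterArc (h + h) d ≡ d
  shorterArc-short {h} {d} d≤h = m≤n⇒m⊓n≡m (begin
    d            ≤⟨ d≤h ⟩
    h            ≡⟨ m+n∸n≡m h h ⟨
    h + h ∸ h    ≤⟨ ∸-monoʳ-≤ (h + h) d≤h ⟩
    h + h ∸ d    ∎)
    where open ≤-Reasoning

  ∣1+m-n∣-cases : ∀ m n → ∣ suc m - n ∣ ≡ suc ∣ m - n ∣ ⊎ ∣ m - n ∣ ≡ suc ∣ suc m - n ∣
  ∣1+m-n∣-cases zero    zero    = inj₁ refl
  ∣1+m-n∣-cases (suc m) zero    = inj₁ refl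
  ∣1+m-n∣-cases zero    (suc n) = inj₂ refl
  ∣1+m-n∣-cases (suc m) (suc n) = ∣1+m-n∣-cases m n

  cycleDist-wraparound : ∀ {x y} → y ≤ x → WithinOne (cycleDist (suc x) x y) (cycleDist (suc x) 0 y)
  cycleDist-wraparound {x} {y} y≤x =
    subst (λ e → WithinOne e (shorterArc (suc x) y)) arc (WithinOne-sym (shorterArc-suc (suc x) y))
    where
    open ≡-Reasoning
    arc : shorterArc (suc x) (suc y) ≡ cycleDist (suc x) x y
    arc = begin
      shorterArc (suc x) (suc y)             ≡⟨ cong (shorterArc (suc x)) (begin
        suc x ∸ (x ∸ y)                        ≡⟨ +-∸-assoc 1 (m∸n≤m x y) ⟩
        suc (x ∸ (x ∸ y))                      ≡⟨ cong suc (m∸[m∸n]≡n y≤x) ⟩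
        suc y                                  ∎) ⟨
      shorterArc (suc x) (suc x ∸ (x ∸ y))   ≡⟨ shorterArc-mirror (≤-trans (m∸n≤m x y) (n≤1+n x)) ⟩
      shorterArc (suc x) (x ∸ y)             ≡⟨ cong (shorterArc (suc x)) (m≤n⇒∣n-m∣≡n∸m y≤x) ⟨
      cycleDist (suc x) x y                  ∎

  cycleDist-suc : ∀ {n} .{{_ : NonZero n}} {x y} → x < n → y < n →
    WithinOne (cycleDist n x y) (cycleDist n (suc x % n) y)
  cycleDist-suc {n} {x} {y} x<n y<n with suc x ℕ.<? n
  ... | yes 1+x<n rewrite m<n⇒m%n≡m 1+x<n with ∣1+m-n∣-cases x y
  ...   | inj₁ e rewrite e = shorterArc-suc n ∣ x - y ∣
  ...   | inj₂ e rewrite e = WithinOne-sym (shorterArc-suc n ∣ suc x - y ∣)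
  cycleDist-suc {n} {x} {y} x<n y<n | no 1+x≮n with ≤-antisym x<n (≮⇒≥ 1+x≮n)
  ... | refl = subst (λ z → WithinOne (cycleDist (suc x) x y) (cycleDist (suc x) z y))
                 (sym (n%n≡0 (suc x))) (cycleDist-wraparound (ℕ.s≤s⁻¹ y<n))

  ∣m-n∣≤o : ∀ {m n o} → n ≤ o → m ≤ n + o → ∣ m - n ∣ ≤ o
  ∣m-n∣≤o {m} {n} n≤o m≤n+o with ∣m-n∣≡[m∸n]∨[n∸m] m n
  ... | inj₁ e = ≤-trans (≤-reflexive e) (m≤n+o⇒m∸n≤o m n m≤n+o)
  ... | inj₂ e = ≤-trans (≤-reflexive e) (≤-trans (m∸n≤m n m) n≤o)

  cycleDist-antipodal : ∀ {h x y} → y ≤ h → x ≤ y + h →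
    cycleDist (h + h) x y + cycleDist (h + h) x (y + h) ≡ h
  cycleDist-antipodal {h} {x} {y} y≤h x≤y+h =
    trans (cong₂ _+_ (shorterArc-short d≤h) far) (m+[n∸m]≡n d≤h)
    where
    open ≡-Reasoning
    d = ∣ x - y ∣
    d≤h : d ≤ h
    d≤h = ∣m-n∣≤o y≤h x≤y+h
    far : cycleDist (h + h) x (y + h) ≡ h ∸ d
    far with ≤-total x y
    ... | inj₁ x≤y = begin
      shorterArc (h + h) ∣ x - y + h ∣      ≡⟨ cong (shorterArc (h + h)) (m≤n⇒∣m-n∣≡n∸m x≤y+h) ⟩
      shorterArc (h + h) (y + h ∸ x)        ≡⟨ cong (shorterArc (h + h)) (begin
        h + h ∸ (h ∸ d)                       ≡⟨ +-∸-assoc h (m∸n≤m h d) ⟩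
        h + (h ∸ (h ∸ d))                     ≡⟨ cong (h +_) (m∸[m∸n]≡n d≤h) ⟩
        h + d                                 ≡⟨ cong (h +_) (m≤n⇒∣m-n∣≡n∸m x≤y) ⟩
        h + (y ∸ x)                           ≡⟨ +-comm h (y ∸ x) ⟩
        y ∸ x + h                             ≡⟨ +-∸-comm h x≤y ⟨
        y + h ∸ x                             ∎) ⟨
      shorterArc (h + h) (h + h ∸ (h ∸ d))  ≡⟨ shorterArc-mirror (≤-trans (m∸n≤m h d) (m≤m+n h h)) ⟩
      shorterArc (h + h) (h ∸ d)            ≡⟨ shorterArc-short (m∸n≤m h d) ⟩
      h ∸ d                                 ∎
    ... | inj₂ y≤x = begin
      shorterArc (h + h) ∣ x - y + h ∣      ≡⟨ cong (shorterArc (h + h)) (m≤n⇒∣m-n∣≡n∸m x≤y+h) ⟩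
      shorterArc (h + h) (y + h ∸ x)        ≡⟨ cong (shorterArc (h + h)) (begin
        y + h ∸ x                             ≡⟨ cong (λ z → y + h ∸ z) (m+[n∸m]≡n y≤x) ⟨
        y + h ∸ (y + (x ∸ y))                 ≡⟨ [m+n]∸[m+o]≡n∸o y h (x ∸ y) ⟩
        h ∸ (x ∸ y)                           ≡⟨ cong (h ∸_) (m≤n⇒∣n-m∣≡n∸m y≤x) ⟨
        h ∸ d                                 ∎) ⟩
      shorterArc (h + h) (h ∸ d)            ≡⟨ shorterArc-short (m∸n≤m h d) ⟩
      h ∸ d                                 ∎

  ∣m-n∣-cases : ∀ m n → m ≡ n + ∣ m - n ∣ ⊎ m + ∣ m - n ∣ ≡ n
  ∣m-n∣-cases m n with ≤-total n m
  ... | inj₁ n≤m = inj₁ (sym (trans (cong (n +_) (m≤n⇒∣n-m∣≡n∸m n≤m)) (m+[n∸m]≡n n≤m)))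
  ... | inj₂ m≤n = inj₂ (trans (cong (m +_) (m≤n⇒∣m-n∣≡n∸m m≤n)) (m+[n∸m]≡n m≤n))

  ∣m-o∣≡∣n-o∣⇒m≡n⊎m+n≡o+o : ∀ {m n o} → ∣ m - o ∣ ≡ ∣ n - o ∣ → m ≡ n ⊎ m + n ≡ o + o
  ∣m-o∣≡∣n-o∣⇒m≡n⊎m+n≡o+o {m} {n} {o} e with ∣m-n∣-cases m o | ∣m-n∣-cases n o
  ... | inj₁ m≡ | inj₁ n≡ = inj₁ (trans m≡ (trans (cong (o +_) e) (sym n≡)))
  ... | inj₂ m+ | inj₂ n+ = inj₁ (+-cancelʳ-≡ ∣ n - o ∣ m n (trans (cong (m +_) (sym e)) (trans m+ (sym n+))))
  ... | inj₁ m≡ | inj₂ n+ = inj₂ (begin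
    m + n                ≡⟨ cong (_+ n) (trans m≡ (cong (o +_) e)) ⟩
    o + ∣ n - o ∣ + n    ≡⟨ +-assoc o _ n ⟩
    o + (∣ n - o ∣ + n)  ≡⟨ cong (o +_) (trans (+-comm _ n) n+) ⟩
    o + o                ∎)
    where open ≡-Reasoning
  ... | inj₂ m+ | inj₁ n≡ = inj₂ (begin
    m + n                ≡⟨ cong (m +_) (trans n≡ (cong (o +_) (sym e))) ⟩
    m + (o + ∣ m - o ∣)  ≡⟨ cong (m +_) (+-comm o _) ⟩
    m + (∣ m - o ∣ + o)  ≡⟨ +-assoc m _ o ⟨
    m + ∣ m - o ∣ + o    ≡⟨ cong (_+ o) m+ ⟩
    o + o                ∎)
    where open ≡-Reasoning

  ∣-∣-injective-≤ : ∀ {m n o} → m ≤ o → n ≤ o → ∣ m - o ∣ ≡ ∣ n - o ∣ → m ≡ n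
  ∣-∣-injective-≤ m≤o n≤o e =
    ∸-cancelˡ-≡ m≤o n≤o (trans (sym (m≤n⇒∣m-n∣≡n∸m m≤o)) (trans e (m≤n⇒∣m-n∣≡n∸m n≤o)))

  ∣-∣-injective-≥ : ∀ {m n o} → o ≤ m → o ≤ n → ∣ m - o ∣ ≡ ∣ n - o ∣ → m ≡ n
  ∣-∣-injective-≥ o≤m o≤n e =
    ∸-cancelʳ-≡ o≤m o≤n (trans (sym (m≤n⇒∣n-m∣≡n∸m o≤m)) (trans e (m≤n⇒∣n-m∣≡n∸m o≤n)))

  private
    twice-+ : ∀ a u u' → 2 * a + (u + u') ≡ (a + u) + (a + u')
    twice-+ = ℕ-Solver.solve-∀

  sums-determine-summands : ∀ {a b u u' w w'} → a + u ≡ b + w → a + u' ≡ b + w' →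
    u + u' ≡ w + w' → a ≡ b × u ≡ w
  sums-determine-summands {a} {b} {u} {u'} {w} {w'} e e' total =
    a≡b , +-cancelˡ-≡ b u w (trans (cong (_+ u) (sym a≡b)) e)
    where
    open ≡-Reasoning
    a≡b : a ≡ b
    a≡b = *-cancelˡ-≡ a b 2 (+-cancelʳ-≡ (u + u') (2 * a) (2 * b) (begin
      2 * a + (u + u')        ≡⟨ twice-+ a u u' ⟩
      (a + u) + (a + u')      ≡⟨ cong₂ _+_ e e' ⟩
      (b + w) + (b + w')      ≡⟨ twice-+ b w w' ⟨
      2 * b + (w + w')        ≡⟨ cong (2 * b +_) total ⟨
      2 * b + (u + u')        ∎))

module _ where

  open import Data.Integer using (+_; _+_; _*_)

  pos-∸ : ∀ {m n} → n ≤ m → + (m ∸ n) ≡ + m - + n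
  pos-∸ {m} {n} n≤m = trans (sym (ℤ.⊖-≥ n≤m)) (sym (ℤ.m-n≡m⊖n m n))

  data Neighbours (i : ℤ) : ℤ → Set where
    up   : Neighbours i (i + 1ℤ)
    down : Neighbours i (i - 1ℤ)

  -- A map of the labels ℤ that descends to an automorphism of the cycle ℤ/nℤ.
  record CycleMap (n : ℕ) (σ : ℤ → ℤ) : Set where
    field
      respects-mod : ∀ i k → ∃[ k' ] σ (i + k * + n) ≡ σ i + k' * + n
      preserves-neighbours : ∀ {i i'} → Neighbours i i' → Neighbours (σ i) (σ i')

  shift : ℤ → ℤ → ℤ
  shift s i = i + s

  mirror : ℤ → ℤ → ℤ
  mirror c i = c - i

  private
    shift-mod : ∀ i k n s → i + k * n + s ≡ i + s + k * n
    shift-mod = solve-∀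
    shift-suc : ∀ i s → i + 1ℤ + s ≡ i + s + 1ℤ
    shift-suc = solve-∀
    shift-pred : ∀ i s → i - 1ℤ + s ≡ i + s - 1ℤ
    shift-pred = solve-∀
    mirror-mod : ∀ i k n c → c - (i + k * n) ≡ c - i + (- k) * n
    mirror-mod = solve-∀
    mirror-suc : ∀ i c → c - (i + 1ℤ) ≡ c - i - 1ℤ
    mirror-suc = solve-∀
    mirror-pred : ∀ i c → c - (i - 1ℤ) ≡ c - i + 1ℤ
    mirror-pred = solve-∀
    mirror-mirror : ∀ c i → c - (c - i) ≡ i
    mirror-mirror = solve-∀

  id-cycleMap : ∀ {n} → CycleMap n (λ i → i)
  id-cycleMap = record { respects-mod = λ i k → k , refl ; preserves-neighbours = λ nb → nb }

  shift-cycleMap : ∀ {n} s → CycleMap n (shift s)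
  shift-cycleMap {n} s = record
    { respects-mod = λ i k → k , shift-mod i k (+ n) s
    ; preserves-neighbours = λ
        { {i} up   → subst (Neighbours (i + s)) (sym (shift-suc i s)) up
        ; {i} down → subst (Neighbours (i + s)) (sym (shift-pred i s)) down } }

  mirror-cycleMap : ∀ {n} c → CycleMap n (mirror c)
  mirror-cycleMap {n} c = record
    { respects-mod = λ i k → - k , mirror-mod i k (+ n) c
    ; preserves-neighbours = λ
        { {i} up   → subst (Neighbours (c - i)) (sym (mirror-suc i c)) down
        ; {i} down → subst (Neighbours (c - i)) (sym (mirror-pred i c)) up } }

  record CycleInvolution (n : ℕ) : Set where
    field
      σ : ℤ → ℤ
      cycleMap : CycleMap n σ
      involutive : ∀ i → σ (σ i) ≡ i

  id-involution : ∀ {n} → CycleInvolution n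
  id-involution = record { σ = λ i → i ; cycleMap = id-cycleMap ; involutive = λ i → refl }

  mirror-involution : ∀ {n} c → CycleInvolution n
  mirror-involution c = record { σ = mirror c ; cycleMap = mirror-cycleMap c ; involutive = mirror-mirror c }

  module _ {n : ℕ} .{{_ : NonZero n}} where

    private
      cancel-common : ∀ r a b n → r + a * n - (r + b * n) ≡ (a - b) * n
      cancel-common = solve-∀
      cancel-multiple : ∀ r r' b n → r' + b * n - (r + b * n) ≡ r' - r
      cancel-multiple = solve-∀
      merge-multiples : ∀ r a k n → r + a * n + k * n ≡ r + (a + k) * n
      merge-multiples = solve-∀
      pred-suc : ∀ i → i - 1ℤ + 1ℤ ≡ i
      pred-suc = solve-∀
      add-sub : ∀ x y → x + y - y ≡ x
      add-sub = solve-∀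
      forward-short : ∀ x y n → x + (y - x) ≡ y + 0ℤ * n
      forward-short = solve-∀
      backward-long : ∀ x y n → x - (n - (y - x)) ≡ y + -1ℤ * n
      backward-long = solve-∀
      backward-short : ∀ x y n → x - (x - y) ≡ y + 0ℤ * n
      backward-short = solve-∀
      forward-long : ∀ x y n → x + (n - (x - y)) ≡ y + 1ℤ * n
      forward-long = solve-∀

    remainder-unique-≤ : ∀ {r r'} a b → r ≤ r' → r' < n → + r + a * + n ≡ + r' + b * + n → r ≡ r'
    remainder-unique-≤ {r} {r'} a b r≤r' r'<n e = ≤-antisym r≤r' (m∸n≡0⇒m≤n (begin
      r' ∸ r        ≡⟨ m<n⇒m%n≡m (≤-<-trans (m∸n≤m r' r) r'<n) ⟨
      (r' ∸ r) % n  ≡⟨ n∣m⇒m%n≡0 (r' ∸ r) n (divides ℤ.∣ a - b ∣ gap-multiple) ⟩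
      0             ∎))
      where
      open ≡-Reasoning
      gap-multiple : r' ∸ r ≡ ℤ.∣ a - b ∣ ℕ.* n
      gap-multiple = trans (cong ℤ.∣_∣ (begin
        + (r' ∸ r)                       ≡⟨ pos-∸ r≤r' ⟩
        + r' - + r                       ≡⟨ cancel-multiple (+ r) (+ r') b (+ n) ⟨
        + r' + b * + n - (+ r + b * + n) ≡⟨ cong (_- (+ r + b * + n)) e ⟨
        + r + a * + n - (+ r + b * + n)  ≡⟨ cancel-common (+ r) a b (+ n) ⟩
        (a - b) * + n                    ∎)) (ℤ.abs-* (a - b) (+ n))

    remainder-unique : ∀ {r r'} a b → r < n → r' < n → + r + a * + n ≡ + r' + b * + n → r ≡ r'
    remainder-unique {r} {r'} a b r<n r'<n e with ≤-total r r'
    ... | inj₁ r≤r' = remainder-unique-≤ a b r≤r' r'<n e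
    ... | inj₂ r'≤r = sym (remainder-unique-≤ b a r'≤r r<n (sym e))

    toℕ-wrap : ∀ i → toℕ (wrap n i) ≡ i %ℕ n
    toℕ-wrap i = toℕ-fromℕ< (n%ℕd<d i n)

    wrap-cong : ∀ {i j} k → i ≡ j + k * + n → wrap n i ≡ wrap n j
    wrap-cong {i} {j} k e = toℕ-injective (trans (toℕ-wrap i) (trans
      (remainder-unique (i /ℕ n) (j /ℕ n + k) (n%ℕd<d i n) (n%ℕd<d j n) (begin
        + (i %ℕ n) + i /ℕ n * + n            ≡⟨ a≡a%ℕn+[a/ℕn]*n i n ⟨
        i                                    ≡⟨ e ⟩
        j + k * + n                          ≡⟨ cong (_+ k * + n) (a≡a%ℕn+[a/ℕn]*n j n) ⟩
        + (j %ℕ n) + j /ℕ n * + n + k * + n  ≡⟨ merge-multiples (+ (j %ℕ n)) (j /ℕ n) k (+ n) ⟩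
        + (j %ℕ n) + (j /ℕ n + k) * + n      ∎))
      (sym (toℕ-wrap j))))
      where open ≡-Reasoning

    toℕ-wrap-< : ∀ {m} → m < n → toℕ (wrap n (+ m)) ≡ m
    toℕ-wrap-< m<n = trans (toℕ-wrap (+ _)) (m<n⇒m%n≡m m<n)

    wrap-toℕ : (x : Fin n) → wrap n (+ toℕ x) ≡ x
    wrap-toℕ x = toℕ-injective (toℕ-wrap-< (toℕ<n x))

    wrap-cycleMap : ∀ {σ} → CycleMap n σ → ∀ i → wrap n (σ (+ toℕ (wrap n i))) ≡ wrap n (σ i)
    wrap-cycleMap {σ} cm i with CycleMap.respects-mod cm (+ (i %ℕ n)) (i /ℕ n)
    ... | k' , e = sym (wrap-cong {j = σ (+ toℕ (wrap n i))} k' (begin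
      σ i                                ≡⟨ cong σ (a≡a%ℕn+[a/ℕn]*n i n) ⟩
      σ (+ (i %ℕ n) + i /ℕ n * + n)      ≡⟨ e ⟩
      σ (+ (i %ℕ n)) + k' * + n          ≡⟨ cong (λ r → σ (+ r) + k' * + n) (toℕ-wrap i) ⟨
      σ (+ toℕ (wrap n i)) + k' * + n    ∎))
      where open ≡-Reasoning

    toℕ-wrap-suc : ∀ i → toℕ (wrap n (i + 1ℤ)) ≡ suc (toℕ (wrap n i)) % n
    toℕ-wrap-suc i = begin
      toℕ (wrap n (i + 1ℤ))                  ≡⟨ cong toℕ (wrap-cycleMap (shift-cycleMap 1ℤ) i) ⟨
      toℕ (wrap n (+ toℕ (wrap n i) + 1ℤ))   ≡⟨ toℕ-wrap (+ (toℕ (wrap n i) ℕ.+ 1)) ⟩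
      (toℕ (wrap n i) ℕ.+ 1) % n             ≡⟨ cong (_% n) (+-comm _ 1) ⟩
      suc (toℕ (wrap n i)) % n               ∎
      where open ≡-Reasoning

    cycleDist-wrap-suc : ∀ i {y} → y < n →
      WithinOne (cycleDist n (toℕ (wrap n i)) y) (cycleDist n (toℕ (wrap n (i + 1ℤ))) y)
    cycleDist-wrap-suc i {y} y<n =
      subst (λ z → WithinOne (cycleDist n (toℕ (wrap n i)) y) (cycleDist n z y))
        (sym (toℕ-wrap-suc i)) (cycleDist-suc (toℕ<n (wrap n i)) y<n)

    cycleDist-wrap-neighbour : ∀ {i i' y} → Neighbours i i' → y < n →
      cycleDist n (toℕ (wrap n i)) y ≤ suc (cycleDist n (toℕ (wrap n i')) y)
    cycleDist-wrap-neighbour {i} up y<n = proj₁ (cycleDist-wrap-suc i y<n)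
    cycleDist-wrap-neighbour {i} {y = y} down y<n =
      subst (λ j → cycleDist n (toℕ (wrap n j)) y ≤ suc (cycleDist n (toℕ (wrap n (i - 1ℤ))) y))
        (pred-suc i) (proj₂ (cycleDist-wrap-suc (i - 1ℤ) y<n))

    sum≡⇒≡wrap-difference : ∀ (a : Fin n) {b s} → + (toℕ a ℕ.+ b) ≡ s → a ≡ wrap n (s - + b)
    sum≡⇒≡wrap-difference a {b} refl = sym (trans (cong (λ z → wrap n (z - + b)) (ℤ.pos-+ (toℕ a) b))
      (trans (cong (wrap n) (add-sub (+ toℕ a) (+ b))) (wrap-toℕ a)))

    private
      arc-choice : ∀ {x y} (δ₁ δ₂ : ℤ) → ℤ.∣ δ₁ ∣ ≡ ∣ x - y ∣ → ℤ.∣ δ₂ ∣ ≡ n ∸ ∣ x - y ∣ →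
        wrap n (+ x + δ₁) ≡ wrap n (+ y) → wrap n (+ x + δ₂) ≡ wrap n (+ y) →
        ∃[ δ ] ℤ.∣ δ ∣ ≡ cycleDist n x y × wrap n (+ x + δ) ≡ wrap n (+ y)
      arc-choice {x} {y} δ₁ δ₂ l₁ l₂ e₁ e₂ with ⊓-sel ∣ x - y ∣ (n ∸ ∣ x - y ∣)
      ... | inj₁ s = δ₁ , trans l₁ (sym s) , e₁
      ... | inj₂ s = δ₂ , trans l₂ (sym s) , e₂

      n∸-difference : ∀ {x y} → x ≤ y → y < n → + (n ∸ (y ∸ x)) ≡ + n - (+ y - + x)
      n∸-difference {x} {y} x≤y y<n =
        trans (pos-∸ (≤-trans (m∸n≤m y x) (<⇒≤ y<n))) (cong (λ z → + n - z) (pos-∸ x≤y))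

    cycleDist-offset : ∀ {x y} → x < n → y < n →
      ∃[ δ ] ℤ.∣ δ ∣ ≡ cycleDist n x y × wrap n (+ x + δ) ≡ wrap n (+ y)
    cycleDist-offset {x} {y} x<n y<n with ≤-total x y
    ... | inj₁ x≤y = arc-choice (+ (y ∸ x)) (- + (n ∸ (y ∸ x)))
      (sym d≡) (trans (ℤ.∣-i∣≡∣i∣ (+ (n ∸ (y ∸ x)))) (cong (n ∸_) (sym d≡)))
      (wrap-cong {j = + y} 0ℤ (trans (cong (λ z → + x + z) (pos-∸ x≤y)) (forward-short (+ x) (+ y) (+ n))))
      (wrap-cong {j = + y} -1ℤ (trans (cong (λ z → + x - z) (n∸-difference x≤y y<n))
        (backward-long (+ x) (+ y) (+ n))))
      where d≡ = m≤n⇒∣m-n∣≡n∸m x≤y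
    ... | inj₂ y≤x = arc-choice (- + (x ∸ y)) (+ (n ∸ (x ∸ y)))
      (trans (ℤ.∣-i∣≡∣i∣ (+ (x ∸ y))) (sym d≡)) (cong (n ∸_) (sym d≡))
      (wrap-cong {j = + y} 0ℤ (trans (cong (λ z → + x - z) (pos-∸ y≤x)) (backward-short (+ x) (+ y) (+ n))))
      (wrap-cong {j = + y} 1ℤ (trans (cong (λ z → + x + z) (n∸-difference y≤x x<n))
        (forward-long (+ x) (+ y) (+ n))))
      where d≡ = m≤n⇒∣n-m∣≡n∸m y≤x

module TorusMetric (p q : ℕ) (4≤q : 4 ≤ q) (q≤p : q ≤ p) where

  open Torus p q 4≤q q≤p
  open import Data.Nat using (_+_)
  open import Data.Integer using (+_)

  torusDist : Vertex → Vertex → ℕ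
  torusDist (a₁ , a₂) (c₁ , c₂) = cycleDist N (toℕ a₁) (toℕ c₁) + cycleDist M (toℕ a₂) (toℕ c₂)

  row-adj : ∀ j {i i'} → Neighbours i i' → Adj (v i j) (v i' j)
  row-adj j {i} up   = i , j , refl , inj₁ refl
  row-adj j {i} down = i , j , refl , inj₂ (inj₁ refl)

  column-adj : ∀ i {j j'} → Neighbours j j' → Adj (v i j) (v i j')
  column-adj i {j} up   = i , j , refl , inj₂ (inj₂ (inj₁ refl))
  column-adj i {j} down = i , j , refl , inj₂ (inj₂ (inj₂ refl))

  torusDist-row-step : ∀ j {i i'} c → Neighbours i i' → torusDist (v i j) c ≤ suc (torusDist (v i' j) c)
  torusDist-row-step j (c₁ , c₂) nb =
    +-monoˡ-≤ (cycleDist M (toℕ (wrap M j)) (toℕ c₂)) (cycleDist-wrap-neighbour nb (toℕ<n c₁))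

  torusDist-column-step : ∀ i {j j'} c → Neighbours j j' → torusDist (v i j) c ≤ suc (torusDist (v i j') c)
  torusDist-column-step i (c₁ , c₂) nb = ≤-trans
    (+-monoʳ-≤ (cycleDist N (toℕ (wrap N i)) (toℕ c₁)) (cycleDist-wrap-neighbour nb (toℕ<n c₂)))
    (≤-reflexive (+-suc _ _))

  torusDist-adj : ∀ {a b} c → Adj a b → torusDist a c ≤ suc (torusDist b c)
  torusDist-adj c (i , j , refl , inj₁ refl)               = torusDist-row-step j {i} c up
  torusDist-adj c (i , j , refl , inj₂ (inj₁ refl))        = torusDist-row-step j {i} c down
  torusDist-adj c (i , j , refl , inj₂ (inj₂ (inj₁ refl))) = torusDist-column-step i {j} c up
  torusDist-adj c (i , j , refl , inj₂ (inj₂ (inj₂ refl))) = torusDist-column-step i {j} c down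

  torusDist-self : ∀ a → torusDist a a ≡ 0
  torusDist-self (a₁ , a₂) =
    cong₂ (λ d e → shorterArc N d + shorterArc M e) (∣n-n∣≡0 (toℕ a₁)) (∣n-n∣≡0 (toℕ a₂))

  torusDist≤length : ∀ {a c m} → Walk a c m → torusDist a c ≤ m
  torusDist≤length {a} here = ≤-reflexive (torusDist-self a)
  torusDist≤length {c = c} (step adj w) = ≤-trans (torusDist-adj c adj) (s≤s (torusDist≤length w))

  _++ᵂ_ : ∀ {a b c k l} → Walk a b k → Walk b c l → Walk a c (k + l)
  here       ++ᵂ w' = w'
  step adj w ++ᵂ w' = step adj (w ++ᵂ w')

  private
    sub-suc : ∀ i k → i - 1ℤ - k ≡ i - (1ℤ ℤ.+ k)
    sub-suc = solve-∀

  module _ (P : ℤ → Vertex) (P-adj : ∀ {i i'} → Neighbours i i' → Adj (P i) (P i')) where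

    ascending-walk : ∀ i k → Walk (P i) (P (i ℤ.+ + k)) k
    ascending-walk i zero    = subst (λ z → Walk (P i) (P z) 0) (sym (ℤ.+-identityʳ i)) here
    ascending-walk i (suc k) = step (P-adj up)
      (subst (λ z → Walk (P (i ℤ.+ 1ℤ)) (P z) k) (ℤ.+-assoc i 1ℤ (+ k)) (ascending-walk (i ℤ.+ 1ℤ) k))

    descending-walk : ∀ i k → Walk (P i) (P (i - + k)) k
    descending-walk i zero    = subst (λ z → Walk (P i) (P z) 0) (sym (ℤ.+-identityʳ i)) here
    descending-walk i (suc k) = step (P-adj down)
      (subst (λ z → Walk (P (i - 1ℤ)) (P z) k) (sub-suc i (+ k)) (descending-walk (i - 1ℤ) k))

    line-walk : ∀ i δ → Walk (P i) (P (i ℤ.+ δ)) ℤ.∣ δ ∣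
    line-walk i (+ k)    = ascending-walk i k
    line-walk i -[1+ k ] = descending-walk i (suc k)

  walk-torusDist : ∀ a c → Walk a c (torusDist a c)
  walk-torusDist (a₁ , a₂) (c₁ , c₂)
    with cycleDist-offset (toℕ<n a₁) (toℕ<n c₁) | cycleDist-offset (toℕ<n a₂) (toℕ<n c₂)
  ... | δ₁ , l₁ , e₁ | δ₂ , l₂ , e₂ =
    subst₂ (λ a c → Walk a c (torusDist (a₁ , a₂) (c₁ , c₂)))
      (cong₂ _,_ (wrap-toℕ a₁) (wrap-toℕ a₂))
      (cong₂ _,_ (trans e₁ (wrap-toℕ c₁)) (trans e₂ (wrap-toℕ c₂)))
      (subst (Walk _ _) (cong₂ _+_ l₁ l₂)
        (line-walk (λ i → v i j) (row-adj j) i δ₁ ++ᵂ line-walk (v (i ℤ.+ δ₁)) (column-adj (i ℤ.+ δ₁)) j δ₂))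
    where
    i = + toℕ a₁
    j = + toℕ a₂

  Dist⇔≡torusDist : ∀ {a c k} → Dist a c k ⇔ k ≡ torusDist a c
  Dist⇔≡torusDist {a} {c} {k} = mk⇔ to from
    where
    to : Dist a c k → k ≡ torusDist a c
    to (w , shortest) with <-cmp k (torusDist a c)
    ... | tri< k< _ _ = ⊥-elim (<⇒≱ k< (torusDist≤length w))
    ... | tri≈ _ k≡ _ = k≡
    ... | tri> _ _ k> = ⊥-elim (shortest (torusDist a c) k> (walk-torusDist a c))
    from : k ≡ torusDist a c → Dist a c k
    from refl = walk-torusDist a c , λ m m< w → <⇒≱ m< (torusDist≤length w)

  AdjPreserving : (Vertex → Vertex) → Set
  AdjPreserving f = ∀ {a b} → Adj a b → Adj (f a) (f b)

  record Automorphism : Set where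
    field
      map inverse : Vertex → Vertex
      map-adj : AdjPreserving map
      inverse-adj : AdjPreserving inverse
      inverse-map : ∀ a → inverse (map a) ≡ a

  map-walk : ∀ {f a b k} → AdjPreserving f → Walk a b k → Walk (f a) (f b) k
  map-walk f-adj here         = here
  map-walk f-adj (step adj w) = step (f-adj adj) (map-walk f-adj w)

  module _ (ρ : Automorphism) where

    open Automorphism ρ

    pull-walk : ∀ {a b k} → Walk (map a) (map b) k → Walk a b k
    pull-walk {a} {b} {k} w =
      subst₂ (λ x y → Walk x y k) (inverse-map a) (inverse-map b) (map-walk inverse-adj w)

    Dist-map⇔ : ∀ {a b k} → Dist a b k ⇔ Dist (map a) (map b) k
    Dist-map⇔ = mk⇔
      (λ (w , shortest) → map-walk map-adj w , λ m m< w' → shortest m m< (pull-walk w'))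
      (λ (w , shortest) → pull-walk w , λ m m< w' → shortest m m< (map-walk map-adj w'))

    HasDV-map⇔ : ∀ {B x dv} → HasDV B x dv ⇔ HasDV (mapProbe map B) (map x) dv
    HasDV-map⇔ = mk⇔
      (λ (d₁ , d₂) → Equivalence.to Dist-map⇔ d₁ , Equivalence.to Dist-map⇔ d₂)
      (λ (d₁ , d₂) → Equivalence.from Dist-map⇔ d₁ , Equivalence.from Dist-map⇔ d₂)

    CopHouse-image : ∀ {B R} → CopHouse B R → CopHouse (mapProbe map B) (image map R)
    CopHouse-image cop _ _ (x , Rx , refl) (y , Ry , refl) dv hx hy =
      cong map (cop x y Rx Ry dv (Equivalence.from HasDV-map⇔ hx) (Equivalence.from HasDV-map⇔ hy))

  lift : (ℤ → ℤ) → (ℤ → ℤ) → Vertex → Vertex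
  lift σ τ (a , b) = v (σ (+ toℕ a)) (τ (+ toℕ b))

  module _ {σ τ : ℤ → ℤ} (cσ : CycleMap N σ) (cτ : CycleMap M τ) where

    lift-v : ∀ i j → lift σ τ (v i j) ≡ v (σ i) (τ j)
    lift-v i j = cong₂ _,_ (wrap-cycleMap cσ i) (wrap-cycleMap cτ j)

    lift-row : ∀ j {i i'} → Neighbours i i' → Adj (lift σ τ (v i j)) (lift σ τ (v i' j))
    lift-row j {i} {i'} nb = subst₂ Adj (sym (lift-v i j)) (sym (lift-v i' j))
      (row-adj (τ j) (CycleMap.preserves-neighbours cσ nb))

    lift-column : ∀ i {j j'} → Neighbours j j' → Adj (lift σ τ (v i j)) (lift σ τ (v i j'))
    lift-column i {j} {j'} nb = subst₂ Adj (sym (lift-v i j)) (sym (lift-v i j'))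
      (column-adj (σ i) (CycleMap.preserves-neighbours cτ nb))

    lift-adj : AdjPreserving (lift σ τ)
    lift-adj (i , j , refl , inj₁ refl)               = lift-row j {i} up
    lift-adj (i , j , refl , inj₂ (inj₁ refl))        = lift-row j {i} down
    lift-adj (i , j , refl , inj₂ (inj₂ (inj₁ refl))) = lift-column i {j} up
    lift-adj (i , j , refl , inj₂ (inj₂ (inj₂ refl))) = lift-column i {j} down

  lift-automorphism : ∀ {σ τ σ⁻¹ τ⁻¹} → CycleMap N σ → CycleMap M τ → CycleMap N σ⁻¹ → CycleMap M τ⁻¹ →
    (∀ i → σ⁻¹ (σ i) ≡ i) → (∀ j → τ⁻¹ (τ j) ≡ j) → Automorphism
  lift-automorphism {σ} {τ} {σ⁻¹} {τ⁻¹} cσ cτ cσ⁻¹ cτ⁻¹ σ⁻¹σ τ⁻¹τ = record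
    { map = lift σ τ
    ; inverse = lift σ⁻¹ τ⁻¹
    ; map-adj = lift-adj cσ cτ
    ; inverse-adj = lift-adj cσ⁻¹ cτ⁻¹
    ; inverse-map = λ (a , b) → begin
        lift σ⁻¹ τ⁻¹ (v (σ (+ toℕ a)) (τ (+ toℕ b)))  ≡⟨ lift-v cσ⁻¹ cτ⁻¹ _ _ ⟩
        v (σ⁻¹ (σ (+ toℕ a))) (τ⁻¹ (τ (+ toℕ b)))     ≡⟨ cong₂ v (σ⁻¹σ _) (τ⁻¹τ _) ⟩
        v (+ toℕ a) (+ toℕ b)                         ≡⟨ cong₂ _,_ (wrap-toℕ a) (wrap-toℕ b) ⟩
        (a , b)                                       ∎ }
    where open ≡-Reasoning

  involution-automorphism : CycleInvolution N → CycleInvolution M → Automorphism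
  involution-automorphism ρ π = lift-automorphism cσ cτ cσ cτ σσ ττ
    where
    open CycleInvolution ρ using () renaming (cycleMap to cσ; involutive to σσ)
    open CycleInvolution π using () renaming (cycleMap to cτ; involutive to ττ)

  private
    shift-shift⁻¹ : ∀ s i → i ℤ.+ s ℤ.+ - s ≡ i
    shift-shift⁻¹ = solve-∀

  translation : ℤ → ℤ → Automorphism
  translation s t = lift-automorphism (shift-cycleMap s) (shift-cycleMap t)
    (shift-cycleMap (- s)) (shift-cycleMap (- t)) (shift-shift⁻¹ s) (shift-shift⁻¹ t)

module ProbeB₁ (p q : ℕ) (4≤q : 4 ≤ q) (q≤p : q ≤ p) where

  open Torus p q 4≤q q≤p
  open TorusMetric p q 4≤q q≤p
  open import Data.Nat using (_+_)
  open import Data.Integer using (+_)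

  b₁ b₂ : Vertex
  b₁ = proj₁ B₁
  b₂ = proj₂ B₁

  c : ℕ
  c = q ∸ 1

  private
    N≡p+p : N ≡ p + p
    N≡p+p = cong (_+_ p) (+-identityʳ p)
    M≡q+q : M ≡ q + q
    M≡q+q = cong (_+_ q) (+-identityʳ q)
    1≤q : 1 ≤ q
    1≤q = ≤-trans (s≤s z≤n) 4≤q
    q≡1+c : q ≡ suc c
    q≡1+c = sym (m+[n∸m]≡n 1≤q)
    c≤q : c ≤ q
    c≤q = m∸n≤m q 1
    M∸1≡c+q : M ∸ 1 ≡ c + q
    M∸1≡c+q = trans (cong (_∸ 1) M≡q+q) (+-∸-comm q 1≤q)
    M≡2+c+c : M ≡ 2 + (c + c)
    M≡2+c+c = trans M≡q+q (trans (cong₂ _+_ q≡1+c q≡1+c) (cong suc (+-suc c c)))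
    p<N : p < N
    p<N = subst (p <_) (sym N≡p+p) (m<m+n p (≤-trans 1≤q q≤p))
    c+q<M : c + q < M
    c+q<M = subst (c + q <_) (trans (cong (_+ q) (sym q≡1+c)) (sym M≡q+q)) (n<1+n (c + q))
    c<M : c < M
    c<M = ≤-<-trans (m≤m+n c q) c+q<M
    1≤M : 1 ≤ M
    1≤M = ≤-trans (s≤s z≤n) c+q<M
    x≤p+p : (x : Fin N) → toℕ x ≤ p + p
    x≤p+p x = <⇒≤ (subst (toℕ x <_) N≡p+p (toℕ<n x))
    y≤c+q : (y : Fin M) → toℕ y ≤ c + q
    y≤c+q y = ℕ.s≤s⁻¹ (subst (toℕ y <_) (trans M≡q+q (cong (_+ q) q≡1+c)) (toℕ<n y))

  toℕ-B₁-row : toℕ (proj₁ b₁) ≡ p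
  toℕ-B₁-row = toℕ-wrap-< p<N

  toℕ-b₁-column : toℕ (proj₂ b₁) ≡ c + q
  toℕ-b₁-column = trans (cong (λ z → toℕ (wrap M z)) (trans (sym (pos-∸ 1≤M)) (cong +_ M∸1≡c+q)))
    (toℕ-wrap-< c+q<M)

  toℕ-b₂-column : toℕ (proj₂ b₂) ≡ c
  toℕ-b₂-column = trans (cong (λ z → toℕ (wrap M z)) (sym (pos-∸ 1≤q))) (toℕ-wrap-< c<M)

  rowOffset columnOffset : Vertex → ℕ
  rowOffset (x₁ , _) = cycleDist N (toℕ x₁) p
  columnOffset (_ , x₂) = cycleDist M (toℕ x₂) c

  columnOffset-antipodal : ∀ x → columnOffset x + cycleDist M (toℕ (proj₂ x)) (c + q) ≡ q
  columnOffset-antipodal (_ , y) =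
    subst (λ n → cycleDist n (toℕ y) c + cycleDist n (toℕ y) (c + q) ≡ q) (sym M≡q+q)
      (cycleDist-antipodal c≤q (y≤c+q y))

  torusDist-b₁ : ∀ x → torusDist x b₁ ≡ rowOffset x + cycleDist M (toℕ (proj₂ x)) (c + q)
  torusDist-b₁ (x₁ , x₂) =
    cong₂ (λ r s → cycleDist N (toℕ x₁) r + cycleDist M (toℕ x₂) s) toℕ-B₁-row toℕ-b₁-column

  torusDist-b₂ : ∀ x → torusDist x b₂ ≡ rowOffset x + columnOffset x
  torusDist-b₂ (x₁ , x₂) =
    cong₂ (λ r s → cycleDist N (toℕ x₁) r + cycleDist M (toℕ x₂) s) toℕ-B₁-row toℕ-b₂-column

  rowOffset≡∣-∣ : ∀ x → rowOffset x ≡ ∣ toℕ (proj₁ x) - p ∣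
  rowOffset≡∣-∣ (x₁ , _) = subst (λ n → shorterArc n ∣ toℕ x₁ - p ∣ ≡ ∣ toℕ x₁ - p ∣) (sym N≡p+p)
    (shorterArc-short (∣m-n∣≤o ≤-refl (x≤p+p x₁)))

  columnOffset≡∣-∣ : ∀ x → columnOffset x ≡ ∣ toℕ (proj₂ x) - c ∣
  columnOffset≡∣-∣ (_ , y) = subst (λ n → shorterArc n ∣ toℕ y - c ∣ ≡ ∣ toℕ y - c ∣) (sym M≡q+q)
    (shorterArc-short (∣m-n∣≤o c≤q (y≤c+q y)))

  HasDV-B₁⇔ : ∀ {x dv} → HasDV B₁ x dv ⇔ (proj₁ dv ≡ torusDist x b₁ × proj₂ dv ≡ torusDist x b₂)
  HasDV-B₁⇔ = mk⇔
    (λ (d₁ , d₂) → Equivalence.to Dist⇔≡torusDist d₁ , Equivalence.to Dist⇔≡torusDist d₂)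
    (λ (e₁ , e₂) → Equivalence.from Dist⇔≡torusDist e₁ , Equivalence.from Dist⇔≡torusDist e₂)

  -- The distances to b₂ and to its antipode b₁ add the same row offset to complementary
  -- column offsets.
  same-dv⇒same-offsets : ∀ {x y dv} → HasDV B₁ x dv → HasDV B₁ y dv →
    rowOffset x ≡ rowOffset y × columnOffset x ≡ columnOffset y
  same-dv⇒same-offsets {x} {y} hx hy with Equivalence.to HasDV-B₁⇔ hx | Equivalence.to HasDV-B₁⇔ hy
  ... | x₁ , x₂ | y₁ , y₂ = sums-determine-summands
    (trans (sym (torusDist-b₂ x)) (trans (trans (sym x₂) y₂) (torusDist-b₂ y)))
    (trans (sym (torusDist-b₁ x)) (trans (trans (sym x₁) y₁) (torusDist-b₁ y)))
    (trans (columnOffset-antipodal x) (sym (columnOffset-antipodal y)))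

  row-reflection : ∀ (a b : Fin N) → ∣ toℕ a - p ∣ ≡ ∣ toℕ b - p ∣ →
    a ≡ wrap N (+ toℕ b) ⊎ a ≡ wrap N (+ N - + toℕ b)
  row-reflection a b e with ∣m-o∣≡∣n-o∣⇒m≡n⊎m+n≡o+o e
  ... | inj₁ a≡b = inj₁ (trans (toℕ-injective a≡b) (sym (wrap-toℕ b)))
  ... | inj₂ a+b = inj₂ (sum≡⇒≡wrap-difference a (cong +_ (trans a+b (sym N≡p+p))))

  column-reflection : ∀ (a b : Fin M) → ∣ toℕ a - c ∣ ≡ ∣ toℕ b - c ∣ →
    a ≡ wrap M (+ toℕ b) ⊎ a ≡ wrap M (+ M - + 2 - + toℕ b)
  column-reflection a b e with ∣m-o∣≡∣n-o∣⇒m≡n⊎m+n≡o+o e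
  ... | inj₁ a≡b = inj₁ (trans (toℕ-injective a≡b) (sym (wrap-toℕ b)))
  ... | inj₂ a+b = inj₂ (sum≡⇒≡wrap-difference a (trans (cong +_ a+b) (sym M-2≡c+c)))
    where
    M-2≡c+c : + M - + 2 ≡ + (c + c)
    M-2≡c+c = trans (sym (pos-∸ (subst (2 ≤_) (sym M≡2+c+c) (m≤m+n 2 _))))
      (cong +_ (trans (cong (_∸ 2) M≡2+c+c) (m+n∸m≡n 2 _)))

  same-offsets⇒O : ∀ x x₀ → rowOffset x ≡ rowOffset x₀ → columnOffset x ≡ columnOffset x₀ →
    O (+ toℕ (proj₁ x₀)) (+ toℕ (proj₂ x₀)) x
  same-offsets⇒O x@(x₁ , x₂) x₀@(y₁ , y₂) er ec = combine
    (row-reflection x₁ y₁ (trans (sym (rowOffset≡∣-∣ x)) (trans er (rowOffset≡∣-∣ x₀))))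
    (column-reflection x₂ y₂ (trans (sym (columnOffset≡∣-∣ x)) (trans ec (columnOffset≡∣-∣ x₀))))
    where
    combine : ∀ {r r' s s'} → x₁ ≡ r ⊎ x₁ ≡ r' → x₂ ≡ s ⊎ x₂ ≡ s' →
      x ≡ (r , s) ⊎ x ≡ (r' , s) ⊎ x ≡ (r , s') ⊎ x ≡ (r' , s')
    combine (inj₁ refl) (inj₁ refl) = inj₁ refl
    combine (inj₂ refl) (inj₁ refl) = inj₂ (inj₁ refl)
    combine (inj₁ refl) (inj₂ refl) = inj₂ (inj₂ (inj₁ refl))
    combine (inj₂ refl) (inj₂ refl) = inj₂ (inj₂ (inj₂ refl))

  module _ (ρ : CycleInvolution N) (π : CycleInvolution M)
    (ρ-fixes-p : wrap N (CycleInvolution.σ ρ (+ p)) ≡ wrap N (+ p))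
    (π-fixes-b₁ : wrap M (CycleInvolution.σ π (+ M - 1ℤ)) ≡ wrap M (+ M - 1ℤ))
    (π-fixes-b₂ : wrap M (CycleInvolution.σ π (+ q - 1ℤ)) ≡ wrap M (+ q - 1ℤ)) where

    open Automorphism (involution-automorphism ρ π) using (map)

    involution-fixes-B₁ : mapProbe map B₁ ≡ B₁
    involution-fixes-B₁ = cong₂ _,_
      (trans (lift-v cσ cτ _ _) (cong₂ _,_ ρ-fixes-p π-fixes-b₁))
      (trans (lift-v cσ cτ _ _) (cong₂ _,_ ρ-fixes-p π-fixes-b₂))
      where
      open CycleInvolution ρ using () renaming (cycleMap to cσ)
      open CycleInvolution π using () renaming (cycleMap to cτ)

    HasDV-B₁-involution : ∀ {x dv} → HasDV B₁ x dv → HasDV B₁ (map x) dv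
    HasDV-B₁-involution {x} {dv} h = subst (λ B → HasDV B (map x) dv) involution-fixes-B₁
      (Equivalence.to (HasDV-map⇔ (involution-automorphism ρ π)) h)

  private
    mirror-fixes-p : wrap N (+ N - + p) ≡ wrap N (+ p)
    mirror-fixes-p = cong (wrap N) (trans (sym (pos-∸ (<⇒≤ p<N)))
      (cong +_ (trans (cong (_∸ p) N≡p+p) (m+n∸m≡n p p))))

    mirror-fixes-b₁ : wrap M (+ M - + 2 - (+ M - 1ℤ)) ≡ wrap M (+ M - 1ℤ)
    mirror-fixes-b₁ = wrap-cong {j = + M - 1ℤ} -1ℤ (antipode (+ M))
      where
      antipode : ∀ m → m - + 2 - (m - 1ℤ) ≡ m - 1ℤ ℤ.+ -1ℤ ℤ.* m
      antipode = solve-∀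

    mirror-fixes-b₂ : wrap M (+ M - + 2 - (+ q - 1ℤ)) ≡ wrap M (+ q - 1ℤ)
    mirror-fixes-b₂ = cong (wrap M) (trans
      (cong (λ m → m - + 2 - (+ q - 1ℤ)) (trans (cong +_ M≡q+q) (ℤ.pos-+ q q)))
      (centre (+ q)))
      where
      centre : ∀ q → q ℤ.+ q - + 2 - (q - 1ℤ) ≡ q - 1ℤ
      centre = solve-∀

  safe-set-shape : (dv : ℕ × ℕ) → AtLeastTwo (SafeSetOf B₁ dv) →
    Σ ℤ λ i → Σ ℤ λ j → (x : Vertex) → SafeSetOf B₁ dv x ⇔ O i j x
  -- One member x₀ of the class already determines it.
  safe-set-shape dv (x₀ , _ , h₀ , _) = + toℕ (proj₁ x₀) , + toℕ (proj₂ x₀) , λ x → mk⇔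
    (λ h → let (er , ec) = same-dv⇒same-offsets h h₀ in same-offsets⇒O x x₀ er ec)
    reflect
    where
    mirror-row = mirror-involution (+ N)
    mirror-column = mirror-involution (+ M - + 2)
    reflect : ∀ {x} → O (+ toℕ (proj₁ x₀)) (+ toℕ (proj₂ x₀)) x → SafeSetOf B₁ dv x
    reflect (inj₁ refl) =
      HasDV-B₁-involution id-involution id-involution refl refl refl h₀
    reflect (inj₂ (inj₁ refl)) =
      HasDV-B₁-involution mirror-row id-involution mirror-fixes-p refl refl h₀
    reflect (inj₂ (inj₂ (inj₁ refl))) =
      HasDV-B₁-involution id-involution mirror-column refl mirror-fixes-b₁ mirror-fixes-b₂ h₀
    reflect (inj₂ (inj₂ (inj₂ refl))) =
      HasDV-B₁-involution mirror-row mirror-column mirror-fixes-p mirror-fixes-b₁ mirror-fixes-b₂ h₀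

  rowOffset-v : ∀ {x} j → x < N → rowOffset (v (+ x) j) ≡ ∣ x - p ∣
  rowOffset-v {x} j x<N = trans (rowOffset≡∣-∣ (v (+ x) j)) (cong (λ z → ∣ z - p ∣) (toℕ-wrap-< x<N))

  columnOffset-v : ∀ i {y} → y < M → columnOffset (v i (+ y)) ≡ ∣ y - c ∣
  columnOffset-v i {y} y<M = trans (columnOffset≡∣-∣ (v i (+ y))) (cong (λ z → ∣ z - c ∣) (toℕ-wrap-< y<M))

  R₁-cop-house : CopHouse B₁ R₁
  R₁-cop-house _ _ (x , y , x≤p , c≤y , y≤ , refl) (x' , y' , x'≤p , c≤y' , y'≤ , refl) dv h h'
    with same-dv⇒same-offsets h h'
  ... | er , ec = cong₂ v
    (cong +_ (∣-∣-injective-≤ x≤p x'≤p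
      (trans (sym (rowOffset-v (+ y) (<N x≤p))) (trans er (rowOffset-v (+ y') (<N x'≤p))))))
    (cong +_ (∣-∣-injective-≥ c≤y c≤y'
      (trans (sym (columnOffset-v (+ x) (<M y≤))) (trans ec (columnOffset-v (+ x') (<M y'≤))))))
    where
    <N : ∀ {z} → z ≤ p → z < N
    <N z≤p = ≤-<-trans z≤p p<N
    <M : ∀ {z} → z ≤ M ∸ 1 → z < M
    <M z≤ = ≤-<-trans z≤ (subst (_< M) (sym M∸1≡c+q) c+q<M)

corollary5p15 : (p q : ℕ) (4≤q : 4 ≤ q) (q≤p : q ≤ p) →
    let open Torus p q 4≤q q≤p in
    ((dv : ℕ × ℕ) → AtLeastTwo (SafeSetOf B₁ dv) →
      Σ ℤ λ i → Σ ℤ λ j → (x : Vertex) → SafeSetOf B₁ dv x ⇔ O i j x)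
    × CopHouse B₁ R₁
    × ((s t : ℤ) → CopHouse (mapProbe (translate s t) B₁) (image (translate s t) R₁))
corollary5p15 p q 4≤q q≤p =
  safe-set-shape , R₁-cop-house , λ s t → CopHouse-image (translation s t) R₁-cop-house
  where
  open TorusMetric p q 4≤q q≤p
  open ProbeB₁ p q 4≤q q≤p
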